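{- Let $K$ be a $^*$-continuous KAT with top, $A$ a top Kleene abstract domain of $K$ with maps $\alpha,\gamma$, $T_{\Sigma,B}$ a KAT language interpreted on $K$, $t\in T_{\Sigma,B}$, and $(a_n)_{n\in\mathbb N}$ a sequence in $K$ such that $\bigvee_na_n$ exists in $K$, $\top\bigvee_na_n=\bigvee_n\top a_n$, and for every $n$ the triple $[a_n]\,t\,[a_{n+1}]$ is valid. Then the triple $[a_0]\,t^*\,[\bigvee_na_n]$ is valid; that is, the rule (limit) is sound.
   Context: Idempotent semiring: $(K,+,0)$ commutative monoid with $a+a=a$, $(K,\cdot,1)$ monoid, two-sided distributivity, $0a=a0=0$; $a\le b$ iff $a+b=b$. KAT: idempotent semiring with Boolean subalgebra $\mathrm{Test}(K)$ (join $+$, meet $\cdot$, complement, bottom $0$, top $1$) and ${}^*$ with $1+aa^*\le a^*$, $1+a^*a\le a^*$, $b+ac\le c\Rightarrow a^*b\le c$, $b+ca\le c\Rightarrow ba^*\le c$. TopKAT: KAT with greatest element $\top$; $^*$-continuous: $\bigvee_nab^nc$ exists and equals $ab^*c$ for all $a,b,c$. $\mathrm{TOP}(K)=\{\top a\mid a\in K\}$. Language: disjoint $\Sigma,B$ ($\mathtt0,\mathtt1\in B$), $\mathrm{Atom}=\Sigma\cup B$, terms $t::=\mathtt a\mid\mathtt0\mid\mathtt1\mid t_1+t_2\mid t_1\cdot t_2\mid t^*$; evaluation $u:\mathrm{Atom}\to K$ with $u(B)\subseteq\mathrm{Test}(K)$ extended homomorphically to $\llbracket\cdot\rrbracket_u$.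 Top Kleene abstract domain: poset $A$, Galois insertion $\alpha:\mathrm{TOP}(K)\to A$, $\gamma:A\to\mathrm{TOP}(K)$ ($\alpha(x)\le_Ay\iff x\le\gamma(y)$, $\alpha\gamma=\mathrm{id}$), countably complete. Abstract semantics: $\mathcal S^\sharp[\mathtt c]x=\alpha(\gamma(x)\llbracket\mathtt c\rrbracket_u)$, $\mathcal S^\sharp[t_1+t_2]x=\mathcal S^\sharp[t_1]x\vee_A\mathcal S^\sharp[t_2]x$, $\mathcal S^\sharp[t_1\cdot t_2]x=\mathcal S^\sharp[t_2](\mathcal S^\sharp[t_1]x)$, $\mathcal S^\sharp[t^*]x=\bigvee_n(\mathcal S^\sharp[t])^nx$. A triple $[a]t[b]$ ($a,b\in K$) is valid iff $\top b\le\top a\llbracket t\rrbracket_u$ and $\mathcal S^\sharp[t]\alpha(\top a)=\alpha(\top b)=\alpha(\top a\llbracket t\rrbracket_u)$. -}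

module Defs where

open import Level using (Level; _⊔_) renaming (suc to lsuc)
open import Data.Nat using (ℕ; zero; suc)
open import Data.Product using (Σ; _×_; _,_; proj₁; proj₂; ∃)
open import Data.Sum using (_⊎_; inj₁; inj₂)
open import Function using (_∘_)
open import Relation.Binary.PropositionalEquality using (_≡_; refl; sym)

record TopKAT (ℓ : Level) : Set (lsuc ℓ) where
  infixl 6 _+_
  infixl 7 _·_
  infix 4 _≤_
  field
    K    : Set ℓ
    _+_  : K → K → K
    _·_  : K → K → K
    0#   : K
    1#   : K
    _*   : K → K
    ⊤    : K
    +-assoc  : ∀ a b c → (a + b) + c ≡ a + (b + c)
    +-comm   : ∀ a b → a + b ≡ b + a
    +-idem   : ∀ a → a + a ≡ a
    +-identʳ : ∀ a → a + 0# ≡ a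
    ·-assoc  : ∀ a b c → (a · b) · c ≡ a · (b · c)
    ·-identˡ : ∀ a → 1# · a ≡ a
    ·-identʳ : ∀ a → a · 1# ≡ a
    distribˡ : ∀ a b c → a · (b + c) ≡ a · b + a · c
    distribʳ : ∀ a b c → (b + c) · a ≡ b · a + c · a
    zeroˡ    : ∀ a → 0# · a ≡ 0#
    zeroʳ    : ∀ a → a · 0# ≡ 0#

  _≤_ : K → K → Set ℓ
  a ≤ b = a + b ≡ b

  field
    Test      : K → Set ℓ
    ¬t        : K → K
    Test-0    : Test 0#
    Test-1    : Test 1#
    Test-+    : ∀ {b c} → Test b → Test c → Test (b + c)
    Test-·    : ∀ {b c} → Test b → Test c → Test (b · c)
    Test-¬    : ∀ {b} → Test b → Test (¬t b)
    test-·-comm  : ∀ {b c} → Test b → Test c → b · c ≡ c · b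
    test-·-idem  : ∀ {b} → Test b → b · b ≡ b
    test-absorb₁ : ∀ {b c} → Test b → Test c → b + b · c ≡ b
    test-absorb₂ : ∀ {b c} → Test b → Test c → b · (b + c) ≡ b
    test-distrib : ∀ {b c d} → Test b → Test c → Test d →
                   b + c · d ≡ (b + c) · (b + d)
    test-compl-+ : ∀ {b} → Test b → b + ¬t b ≡ 1#
    test-compl-· : ∀ {b} → Test b → b · ¬t b ≡ 0#
    star-unfoldˡ : ∀ a → 1# + a · (a *) ≤ a *
    star-unfoldʳ : ∀ a → 1# + (a *) · a ≤ a *
    star-indˡ    : ∀ a b c → b + a · c ≤ c → (a *) · b ≤ c
    star-indʳ    : ∀ a b c → b + c · a ≤ c → b · (a *) ≤ c
    ⊤-max : ∀ a → a ≤ ⊤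

  IsLub : (ℕ → K) → K → Set ℓ
  IsLub f s = (∀ n → f n ≤ s) × (∀ u → (∀ n → f n ≤ u) → s ≤ u)

  _^_ : K → ℕ → K
  a ^ zero  = 1#
  a ^ suc n = a · (a ^ n)

  StarContinuous : Set ℓ
  StarContinuous = ∀ a b c → IsLub (λ n → a · (b ^ n) · c) (a · (b *) · c)

  TOP : Set ℓ
  TOP = Σ K (λ x → ∃ (λ a → x ≡ ⊤ · a))

  ⊤[_] : K → TOP
  ⊤[ a ] = ⊤ · a , a , refl

  _·ᵀ_ : TOP → K → TOP
  (x , a , p) ·ᵀ k = x · k , a · k , h p
    where
      h : x ≡ ⊤ · a → x · k ≡ ⊤ · (a · k)
      h refl = ·-assoc ⊤ a k

record TopKleeneAbsDomain {ℓ} (KA : TopKAT ℓ) (ℓa : Level) : Set (lsuc (ℓ ⊔ ℓa)) where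
  open TopKAT KA using (TOP) renaming (_≤_ to _≤K_)
  infix 4 _⊑_
  field
    A      : Set ℓa
    _⊑_    : A → A → Set ℓa
    ⊑-refl    : ∀ x → x ⊑ x
    ⊑-trans   : ∀ {x y z} → x ⊑ y → y ⊑ z → x ⊑ z
    ⊑-antisym : ∀ {x y} → x ⊑ y → y ⊑ x → x ≡ y
    α : TOP → A
    γ : A → TOP
    galois-to   : ∀ x y → α x ⊑ y → proj₁ x ≤K proj₁ (γ y)
    galois-from : ∀ x y → proj₁ x ≤K proj₁ (γ y) → α x ⊑ y
    αγ≡id : ∀ y → α (γ y) ≡ y
    -- countable completeness: every countable family has a join
    -- (finite families included; binary joins are given explicitly)
    _∨_    : A → A → A
    ∨-ub₁  : ∀ x y → x ⊑ x ∨ y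
    ∨-ub₂  : ∀ x y → y ⊑ x ∨ y
    ∨-least : ∀ x y z → x ⊑ z → y ⊑ z → x ∨ y ⊑ z
    ⋁      : (ℕ → A) → A
    ⋁-ub   : ∀ f n → f n ⊑ ⋁ f
    ⋁-least : ∀ f z → (∀ n → f n ⊑ z) → ⋁ f ⊑ z

record KATLanguage {ℓ} (KA : TopKAT ℓ) (ℓs : Level) : Set (lsuc ℓs ⊔ ℓ) where
  open TopKAT KA
  field
    Act  : Set ℓs
    Prim : Set ℓs
    𝟘b   : Prim
    𝟙b   : Prim
    u      : Act ⊎ Prim → K
    u-test : ∀ b → Test (u (inj₂ b))
    u-𝟘    : u (inj₂ 𝟘b) ≡ 0#
    u-𝟙    : u (inj₂ 𝟙b) ≡ 1#

  Atom : Set ℓs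
  Atom = Act ⊎ Prim

  data Term : Set ℓs where
    atom : Atom → Term
    _⊕_  : Term → Term → Term
    _⊗_  : Term → Term → Term
    _⊛   : Term → Term

  𝟘 𝟙 : Term
  𝟘 = atom (inj₂ 𝟘b)
  𝟙 = atom (inj₂ 𝟙b)

  ⟦_⟧ : Term → K
  ⟦ atom c ⟧ = u c
  ⟦ t₁ ⊕ t₂ ⟧ = ⟦ t₁ ⟧ + ⟦ t₂ ⟧
  ⟦ t₁ ⊗ t₂ ⟧ = ⟦ t₁ ⟧ · ⟦ t₂ ⟧
  ⟦ t ⊛ ⟧ = ⟦ t ⟧ *

iterate : ∀ {a} {X : Set a} → (X → X) → ℕ → X → X
iterate f zero    x = x
iterate f (suc n) x = f (iterate f n x)

module Semantics {ℓ ℓa ℓs} (KA : TopKAT ℓ) (AD : TopKleeneAbsDomain KA ℓa)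
                 (L : KATLanguage KA ℓs) where
  open TopKAT KA
  open TopKleeneAbsDomain AD
  open KATLanguage L

  S♯ : Term → A → A
  S♯ (atom c)  x = α (γ x ·ᵀ u c)
  S♯ (t₁ ⊕ t₂) x = S♯ t₁ x ∨ S♯ t₂ x
  S♯ (t₁ ⊗ t₂) x = S♯ t₂ (S♯ t₁ x)
  S♯ (t ⊛)     x = ⋁ (λ n → iterate (S♯ t) n x)

  Valid : K → Term → K → Set (ℓ ⊔ ℓa)
  Valid a t b = (⊤ · b ≤ (⊤ · a) · ⟦ t ⟧)
              × (S♯ t (α ⊤[ a ]) ≡ α ⊤[ b ])
              × (α ⊤[ b ] ≡ α (⊤[ a ] ·ᵀ ⟦ t ⟧))

{-# OPTIONS --safe #-}
module Submission where

-- The abstract semantics is sound, γ x · ⟦t⟧ ≤ γ (S♯ t x), by induction on t, with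
-- *-continuity handling the star case. The valid triples make the orbit of α(⊤a₀)
-- under S♯ t exactly α(⊤aₙ), and the premises give ⊤aₙ₊₁ ≤ ⊤aₙ⟦t⟧, so ⊤aₙ ≤ ⊤a₀⟦t⟧*.
-- Since ⊤s = ⋁ₙ ⊤aₙ and α preserves this join, S♯ (t*) α(⊤a₀) = ⋁ₙ α(⊤aₙ) = α(⊤s);
-- soundness then sandwiches ⊤a₀⟦t⟧* between ⊤s and γ α(⊤s), so both have image α(⊤s).

open import Defs
open import Data.Nat using (ℕ; zero; suc)
open import Data.Product using (_,_; proj₁; proj₂)
open import Function using (_∘_)
open import Relation.Binary.Bundles using (Preorder)
import Relation.Binary.Reasoning.Preorder as PreorderReasoning
open import Relation.Binary.PropositionalEquality
  using (_≡_; refl; sym; trans; cong; subst; isEquivalence)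

iterate-suc : ∀ {a} {X : Set a} (f : X → X) n x →
              iterate f (suc n) x ≡ iterate f n (f x)
iterate-suc f zero    x = refl
iterate-suc f (suc n) x = cong f (iterate-suc f n x)

iterate-orbit : ∀ {a} {X : Set a} (f : X → X) (g : ℕ → X) →
                (∀ n → f (g n) ≡ g (suc n)) → ∀ n → iterate f n (g 0) ≡ g n
iterate-orbit f g step zero    = refl
iterate-orbit f g step (suc n) = trans (cong f (iterate-orbit f g step n)) (step n)

module KleeneOrder {ℓ} (KA : TopKAT ℓ) where
  open TopKAT KA

  ≡⇒≤ : ∀ {a b} → a ≡ b → a ≤ b
  ≡⇒≤ {a} refl = +-idem a

  ≤-trans : ∀ {a b c} → a ≤ b → b ≤ c → a ≤ c
  ≤-trans {a} {b} {c} a≤b b≤c =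
    trans (cong (a +_) (sym b≤c)) (trans (sym (+-assoc a b c)) (trans (cong (_+ c) a≤b) b≤c))

  ≤-preorder : Preorder ℓ ℓ ℓ
  ≤-preorder = record
    { isPreorder = record { isEquivalence = isEquivalence ; reflexive = ≡⇒≤ ; trans = ≤-trans } }

  module ≤-Reasoning = PreorderReasoning ≤-preorder

  ·-monoˡ : ∀ {a b} c → a ≤ b → a · c ≤ b · c
  ·-monoˡ {a} {b} c a≤b = trans (sym (distribʳ c a b)) (cong (_· c) a≤b)

  ·-monoʳ : ∀ {a b} c → a ≤ b → c · a ≤ c · b
  ·-monoʳ {a} {b} c a≤b = trans (sym (distribˡ c a b)) (cong (c ·_) a≤b)

  +-lub : ∀ {a b c} → a ≤ c → b ≤ c → a + b ≤ c
  +-lub {a} {b} {c} a≤c b≤c = trans (+-assoc a b c) (trans (cong (a +_) b≤c) a≤c)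

  x≤x+y : ∀ a b → a ≤ a + b
  x≤x+y a b = trans (sym (+-assoc a a b)) (cong (_+ b) (+-idem a))

  y≤x+y : ∀ a b → b ≤ a + b
  y≤x+y a b = subst (b ≤_) (+-comm b a) (x≤x+y b a)

  1≤* : ∀ a → 1# ≤ a *
  1≤* a = ≤-trans (x≤x+y 1# (a · a *)) (star-unfoldˡ a)

  *·≤* : ∀ a → a * · a ≤ a *
  *·≤* a = ≤-trans (y≤x+y 1# (a * · a)) (star-unfoldʳ a)

  ·*-least : StarContinuous → ∀ a b u → (∀ n → a · b ^ n ≤ u) → a · b * ≤ u
  ·*-least sc a b u bound = begin
    a · b *      ≡⟨ sym (·-identʳ _) ⟩
    a · b * · 1# ≲⟨ proj₂ (sc a b 1#) u (λ n → ≤-trans (≡⇒≤ (·-identʳ _)) (bound n)) ⟩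
    u            ∎
    where open ≤-Reasoning

  ≤-·*-of-steps : (b : ℕ → K) (k : K) → (∀ n → b (suc n) ≤ b n · k) →
                  ∀ n → b n ≤ b 0 · k *
  ≤-·*-of-steps b k step zero = begin
    b 0        ≡⟨ sym (·-identʳ _) ⟩
    b 0 · 1#   ≲⟨ ·-monoʳ (b 0) (1≤* k) ⟩
    b 0 · k *  ∎
    where open ≤-Reasoning
  ≤-·*-of-steps b k step (suc n) = begin
    b (suc n)        ≲⟨ step n ⟩
    b n · k          ≲⟨ ·-monoˡ k (≤-·*-of-steps b k step n) ⟩
    b 0 · k * · k    ≡⟨ ·-assoc _ _ _ ⟩
    b 0 · (k * · k)  ≲⟨ ·-monoʳ (b 0) (*·≤* k) ⟩
    b 0 · k *        ∎
    where open ≤-Reasoning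

module GaloisInsertion {ℓ ℓa} (KA : TopKAT ℓ) (AD : TopKleeneAbsDomain KA ℓa) where
  open TopKAT KA
  open TopKleeneAbsDomain AD
  open KleeneOrder KA

  γ-mono : ∀ {y y′} → y ⊑ y′ → proj₁ (γ y) ≤ proj₁ (γ y′)
  γ-mono {y} {y′} y⊑y′ = galois-to (γ y) y′ (subst (_⊑ y′) (sym (αγ≡id y)) y⊑y′)

  ≤γα : ∀ x → proj₁ x ≤ proj₁ (γ (α x))
  ≤γα x = galois-to x (α x) (⊑-refl (α x))

  α-≡ : ∀ {x y} → proj₁ x ≤ proj₁ (γ (α y)) → proj₁ y ≤ proj₁ (γ (α x)) → α x ≡ α y
  α-≡ {x} {y} x≤ y≤ = ⊑-antisym (galois-from x (α y) x≤) (galois-from y (α x) y≤)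

  ⋁-cong : ∀ {f g} → (∀ n → f n ≡ g n) → ⋁ f ≡ ⋁ g
  ⋁-cong {f} {g} f≡g = ⊑-antisym
    (⋁-least f (⋁ g) λ n → subst (_⊑ ⋁ g) (sym (f≡g n)) (⋁-ub g n))
    (⋁-least g (⋁ f) λ n → subst (_⊑ ⋁ f) (f≡g n) (⋁-ub f n))

  α-preserves-lub : (f : ℕ → TOP) (x : TOP) → IsLub (proj₁ ∘ f) (proj₁ x) →
                    ⋁ (α ∘ f) ≡ α x
  α-preserves-lub f x (upper , least) = ⊑-antisym
    (⋁-least (α ∘ f) (α x) λ n → galois-from (f n) (α x) (≤-trans (upper n) (≤γα x)))
    (galois-from x (⋁ (α ∘ f)) (least _ λ n → galois-to (f n) _ (⋁-ub (α ∘ f) n)))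

  γ-iterate : (f : A → A) (k : K) → (∀ x → proj₁ (γ x) · k ≤ proj₁ (γ (f x))) →
              ∀ n x → proj₁ (γ x) · k ^ n ≤ proj₁ (γ (iterate f n x))
  γ-iterate f k sound zero    x = ≡⇒≤ (·-identʳ _)
  γ-iterate f k sound (suc n) x = begin
    proj₁ (γ x) · (k · k ^ n)        ≡⟨ sym (·-assoc _ _ _) ⟩
    proj₁ (γ x) · k · k ^ n          ≲⟨ ·-monoˡ (k ^ n) (sound x) ⟩
    proj₁ (γ (f x)) · k ^ n          ≲⟨ γ-iterate f k sound n (f x) ⟩
    proj₁ (γ (iterate f n (f x)))    ≡⟨ cong (proj₁ ∘ γ) (sym (iterate-suc f n x)) ⟩
    proj₁ (γ (iterate f (suc n) x))  ∎
    where open ≤-Reasoning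

module AbstractSemanticsSoundness {ℓ ℓa ℓs} (KA : TopKAT ℓ) (sc : TopKAT.StarContinuous KA)
                                  (AD : TopKleeneAbsDomain KA ℓa) (L : KATLanguage KA ℓs) where
  open TopKAT KA
  open TopKleeneAbsDomain AD
  open KATLanguage L
  open Semantics KA AD L
  open KleeneOrder KA
  open GaloisInsertion KA AD

  S♯-sound : ∀ t x → proj₁ (γ x) · ⟦ t ⟧ ≤ proj₁ (γ (S♯ t x))
  S♯-sound (atom c) x = ≤γα (γ x ·ᵀ u c)
  S♯-sound (t₁ ⊕ t₂) x = begin
    proj₁ (γ x) · (⟦ t₁ ⟧ + ⟦ t₂ ⟧)                ≡⟨ distribˡ _ _ _ ⟩
    proj₁ (γ x) · ⟦ t₁ ⟧ + proj₁ (γ x) · ⟦ t₂ ⟧    ≲⟨ +-lub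
      (≤-trans (S♯-sound t₁ x) (γ-mono (∨-ub₁ _ _)))
      (≤-trans (S♯-sound t₂ x) (γ-mono (∨-ub₂ _ _))) ⟩
    proj₁ (γ (S♯ t₁ x ∨ S♯ t₂ x))                  ∎
    where open ≤-Reasoning
  S♯-sound (t₁ ⊗ t₂) x = begin
    proj₁ (γ x) · (⟦ t₁ ⟧ · ⟦ t₂ ⟧)    ≡⟨ sym (·-assoc _ _ _) ⟩
    proj₁ (γ x) · ⟦ t₁ ⟧ · ⟦ t₂ ⟧      ≲⟨ ·-monoˡ ⟦ t₂ ⟧ (S♯-sound t₁ x) ⟩
    proj₁ (γ (S♯ t₁ x)) · ⟦ t₂ ⟧       ≲⟨ S♯-sound t₂ (S♯ t₁ x) ⟩
    proj₁ (γ (S♯ t₂ (S♯ t₁ x)))        ∎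
    where open ≤-Reasoning
  S♯-sound (t ⊛) x = ·*-least sc (proj₁ (γ x)) ⟦ t ⟧ _ λ n →
    ≤-trans (γ-iterate (S♯ t) ⟦ t ⟧ (S♯-sound t) n x)
            (γ-mono (⋁-ub (λ m → iterate (S♯ t) m x) n))

lemma6 : ∀ {ℓ ℓa ℓs} (KA : TopKAT ℓ) → TopKAT.StarContinuous KA →
         (AD : TopKleeneAbsDomain KA ℓa) (L : KATLanguage KA ℓs) →
         (t : KATLanguage.Term L) (a : ℕ → TopKAT.K KA) (s : TopKAT.K KA) →
         TopKAT.IsLub KA a s →
         TopKAT.IsLub KA (λ n → TopKAT._·_ KA (TopKAT.⊤ KA) (a n))
                         (TopKAT._·_ KA (TopKAT.⊤ KA) s) →
         (∀ n → Semantics.Valid KA AD L (a n) t (a (suc n))) →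
         Semantics.Valid KA AD L (a 0) (KATLanguage._⊛ t) s
lemma6 KA sc AD L t a s _ ⊤a-lub valid = ⊤s≤⊤a₀T* , S♯t*≡α⊤s , α-agrees
  where
    open TopKAT KA
    open TopKleeneAbsDomain AD
    open KATLanguage L
    open Semantics KA AD L
    open KleeneOrder KA
    open GaloisInsertion KA AD
    open AbstractSemanticsSoundness KA sc AD L

    ⊤s≤⊤a₀T* : ⊤ · s ≤ ⊤ · a 0 · ⟦ t ⟧ *
    ⊤s≤⊤a₀T* = proj₂ ⊤a-lub _ (≤-·*-of-steps (λ n → ⊤ · a n) ⟦ t ⟧ (proj₁ ∘ valid))

    S♯t*≡α⊤s : S♯ (t ⊛) (α ⊤[ a 0 ]) ≡ α ⊤[ s ]
    S♯t*≡α⊤s = trans (⋁-cong (iterate-orbit (S♯ t) (λ n → α ⊤[ a n ]) (proj₁ ∘ proj₂ ∘ valid)))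
                     (α-preserves-lub (λ n → ⊤[ a n ]) ⊤[ s ] ⊤a-lub)

    ⊤a₀T*≤γα⊤s : ⊤ · a 0 · ⟦ t ⟧ * ≤ proj₁ (γ (α ⊤[ s ]))
    ⊤a₀T*≤γα⊤s = begin
      ⊤ · a 0 · ⟦ t ⟧ *                        ≲⟨ ·-monoˡ (⟦ t ⟧ *) (≤γα ⊤[ a 0 ]) ⟩
      proj₁ (γ (α ⊤[ a 0 ])) · ⟦ t ⟧ *         ≲⟨ S♯-sound (t ⊛) (α ⊤[ a 0 ]) ⟩
      proj₁ (γ (S♯ (t ⊛) (α ⊤[ a 0 ])))        ≡⟨ cong (proj₁ ∘ γ) S♯t*≡α⊤s ⟩
      proj₁ (γ (α ⊤[ s ]))                     ∎
      where open ≤-Reasoning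

    α-agrees : α ⊤[ s ] ≡ α (⊤[ a 0 ] ·ᵀ (⟦ t ⟧ *))
    α-agrees = α-≡ (≤-trans ⊤s≤⊤a₀T* (≤γα (⊤[ a 0 ] ·ᵀ (⟦ t ⟧ *)))) ⊤a₀T*≤γα⊤s
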